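{- Let $n \geq 4$ be even, let $A = \{1, \dots, n/2\}$ and $B = \{n/2+1, \dots, n\}$, and let $G$ be the graph on $A \cup B$ consisting of a complete graph on $A$, a complete graph on $B$, and a perfect matching between $A$ and $B$. Then $\delta(G) = n/2$ and $m(G, 3) > 3$.
   Context: Graphs are finite and simple; $\delta(G)$ is the minimum degree and $N(v)$ the neighbourhood of $v$. For an integer $r \geq 2$, the $r$-neighbour bootstrap process on $G$ started from $X \subseteq V(G)$ is defined by $X_0 = X$ and $X_t = X_{t-1} \cup \{v \in V(G) : |N(v) \cap X_{t-1}| \geq r\}$ for $t \geq 1$. The closure is $\langle X \rangle_r = \bigcup_{t \geq 0} X_t$. The set $X$ percolates if $\langle X \rangle_r = V(G)$. Define $m(G,r) = \min\{|X| : X \subseteq V(G),\ \langle X \rangle_r = V(G)\}$. -}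

module Defs where

open import Data.Nat using (ℕ; zero; _<_; suc; _+_; _≤ᵇ_; _<ᵇ_; _⊓_; _/_)
open import Data.Nat.Properties using (_≟_)
open import Data.Bool using (Bool; true; false; _∧_; _∨_; not)
open import Data.Fin using (Fin; toℕ) renaming (zero to fzero; suc to fsuc)
open import Data.Fin.Subset using (Subset; _∩_; _∪_; ∣_∣; _∈_)
open import Data.Vec using (tabulate)
open import Data.Product using (∃)
open import Relation.Nullary.Decidable using (⌊_⌋)
open import Relation.Binary.PropositionalEquality using (_≡_; refl; sym)
open import Relation.Nullary using (yes; no)
open import Data.Empty using (⊥-elim)

record Graph (n : ℕ) : Set where
  field
    adj     : Fin n → Fin n → Bool
    symm    : ∀ u v → adj u v ≡ adj v u
    irrefl  : ∀ v → adj v v ≡ false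
open Graph public

N : ∀ {n} → Graph n → Fin n → Subset n
N G v = tabulate (adj G v)

degree : ∀ {n} → Graph n → Fin n → ℕ
degree G v = ∣ N G v ∣

minFin : ∀ {k} → (Fin (suc k) → ℕ) → ℕ
minFin {zero}  f = f fzero
minFin {suc k} f = f fzero ⊓ minFin (λ i → f (fsuc i))

-- Minimum degree δ(G). (For the empty graph we set δ = 0 by convention;
-- this case is never used below since n ≥ 4.)
δ : ∀ {n} → Graph n → ℕ
δ {zero}  G = 0
δ {suc k} G = minFin (degree G)

step : ∀ {n} → Graph n → ℕ → Subset n → Subset n
step G r X = X ∪ tabulate (λ v → r ≤ᵇ ∣ N G v ∩ X ∣)

bootstrap : ∀ {n} → Graph n → ℕ → Subset n → ℕ → Subset n
bootstrap G r X zero    = X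
bootstrap G r X (suc t) = step G r (bootstrap G r X t)

InClosure : ∀ {n} → Graph n → ℕ → Subset n → Fin n → Set
InClosure G r X v = ∃ λ t → v ∈ bootstrap G r X t

Percolates : ∀ {n} → Graph n → ℕ → Subset n → Set
Percolates G r X = ∀ v → InClosure G r X v

-- m(G,r) > k :  the minimum size of a percolating set exceeds k, i.e.
-- every percolating set X has |X| > k.
MGreater : ∀ {n} → Graph n → ℕ → ℕ → Set
MGreater G r k = ∀ X → Percolates G r X → k < ∣ X ∣

-- The graph of Theorem 2.3 on Fin n with h = n/2:
-- A = {0,…,h-1}, B = {h,…,n-1} (0-indexed), complete on A, complete on B,
-- perfect matching i ↔ i + h between A and B.
twoCliquesAdjℕ : ℕ → ℕ → ℕ → Bool
twoCliquesAdjℕ h a b =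
  not ⌊ a ≟ b ⌋ ∧
  ( ((a <ᵇ h) ∧ (b <ᵇ h))
  ∨ (not (a <ᵇ h) ∧ not (b <ᵇ h))
  ∨ ⌊ a + h ≟ b ⌋
  ∨ ⌊ b + h ≟ a ⌋ )

private
  ≟-sym : ∀ a b → ⌊ a ≟ b ⌋ ≡ ⌊ b ≟ a ⌋
  ≟-sym a b with a ≟ b | b ≟ a
  ... | yes _ | yes _ = refl
  ... | no _  | no _  = refl
  ... | yes p | no q  = ⊥-elim (q (sym p))
  ... | no p  | yes q = ⊥-elim (p (sym q))

  ≟-refl : ∀ a → ⌊ a ≟ a ⌋ ≡ true
  ≟-refl a with a ≟ a
  ... | yes _ = refl
  ... | no p  = ⊥-elim (p refl)

  ∧-comm' : ∀ x y → (x ∧ y) ≡ (y ∧ x)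
  ∧-comm' false false = refl
  ∧-comm' false true  = refl
  ∧-comm' true  false = refl
  ∧-comm' true  true  = refl

  ∨-comm' : ∀ x y → (x ∨ y) ≡ (y ∨ x)
  ∨-comm' false false = refl
  ∨-comm' false true  = refl
  ∨-comm' true  false = refl
  ∨-comm' true  true  = refl

twoCliquesAdjℕ-sym : ∀ h a b → twoCliquesAdjℕ h a b ≡ twoCliquesAdjℕ h b a
twoCliquesAdjℕ-sym h a b
  rewrite ≟-sym a b | ∧-comm' (a <ᵇ h) (b <ᵇ h)
        | ∧-comm' (not (a <ᵇ h)) (not (b <ᵇ h))
        | ∨-comm' ⌊ a + h ≟ b ⌋ ⌊ b + h ≟ a ⌋ = refl

twoCliquesAdjℕ-irrefl : ∀ h a → twoCliquesAdjℕ h a a ≡ false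
twoCliquesAdjℕ-irrefl h a rewrite ≟-refl a = refl

twoCliquesMatching : (n : ℕ) → Graph n
twoCliquesMatching n = record
  { adj    = λ u v → twoCliquesAdjℕ (n / 2) (toℕ u) (toℕ v)
  ; symm   = λ u v → twoCliquesAdjℕ-sym (n / 2) (toℕ u) (toℕ v)
  ; irrefl = λ v → twoCliquesAdjℕ-irrefl (n / 2) (toℕ v)
  }

-- Split Fin (h + h) into the halves A = Fin h ↑ˡ h and B = h ↑ʳ Fin h. The vertex i of either
-- half is adjacent to every other vertex of its own half and to the vertex i of the other one,
-- so its neighbourhood is ∁ ⁅ i ⁆ on its own side and ⁅ i ⁆ on the other, and δ = h.
-- If a half S contains at most one vertex of X, then X ∪ ∁ S is closed under the 3-neighbour
-- rule: a vertex of S outside X sees only its partner and that one vertex of X ∩ S. So a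
-- percolating set has at least two vertices in each half, hence at least four.
module Submission where

open import Defs
open import Data.Bool using (true; false; not; _∧_)
open import Data.Bool.Properties using (T-≡; ∧-identityʳ; ∨-identityʳ)
open import Data.Empty using (⊥-elim)
open import Data.Fin using (Fin; zero; suc; toℕ; _↑ˡ_; _↑ʳ_)
open import Data.Fin.Properties using (toℕ-↑ˡ; toℕ-↑ʳ; toℕ<n)
open import Data.Fin.Subset using (Subset; ⊤; ⊥; ⁅_⁆; ∁; _∩_; _∪_; ∣_∣; _∈_; _∉_; _⊆_)
open import Data.Fin.Subset.Properties
  using (_∈?_; ∉⊥; ∣⊤∣≡n; ∣⊥∣≡0; ∣⁅x⁆∣≡1; ∣p∣≤n; ∣∁p∣≡n∸∣p∣; ∣p∣≤∣x∷p∣; p⊆q⇒∣p∣≤∣q∣;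
         p⊆p∪q; x∈p∪q⁺; x∈p∪q⁻; x∈p∩q⁺; x∈p∩q⁻; x∈p⇒x∉∁p; x∉∁p⇒x∈p; ∩-zeroʳ; ∩-identityʳ)
open import Data.Nat using (ℕ; _+_; _*_; _⊓_; _≤_; _<_; _<ᵇ_; _/_; _%_; z≤n; s≤s; s≤s⁻¹)
open import Data.Nat.Properties
  using (_≟_; _<?_; _≤?_; ⊓-idem; ≤-refl; ≤-reflexive; ≤-trans; <⇒≱; ≤⇒≯; ≰⇒>; ≤ᵇ⇒≤;
         +-suc; +-comm; +-identityʳ; *-comm; +-mono-≤; +-monoˡ-≤; +-monoʳ-≤; *-cancelʳ-≤;
         m≤m+n; m≤n+m; m∸n+n≡m; +-cancelˡ-≡; +-cancelʳ-≡; suc-injective; module ≤-Reasoning)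
open import Data.Nat.DivMod using (m≡m%n+[m/n]*n; m*n/n≡m)
open import Data.Product using (_×_; _,_)
open import Data.Sum using (inj₁; inj₂)
open import Data.Vec using ([]; _∷_; there; _++_; tabulate)
open import Data.Vec.Properties
  using (tabulate-cong; tabulate-∘; tabulate-allFin; map-const; map-++; map-replicate; zipWith-++;
         lookup∘tabulate; []=⇒lookup)
open import Function using (_∘_; _⇔_; mk⇔; Equivalence)
open import Relation.Nullary using (Dec; yes; no; ¬_)
open import Relation.Nullary.Decidable using (⌊_⌋; isYes≗does; does-⇔; dec-true; dec-false)
open import Relation.Binary.PropositionalEquality
  using (_≡_; refl; sym; trans; cong; cong₂; subst; module ≡-Reasoning)

private variable m n : ℕ

∣p++q∣≡∣p∣+∣q∣ : (p : Subset m) (q : Subset n) → ∣ p ++ q ∣ ≡ ∣ p ∣ + ∣ q ∣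
∣p++q∣≡∣p∣+∣q∣ []          q = refl
∣p++q∣≡∣p∣+∣q∣ (true  ∷ p) q = cong ℕ.suc (∣p++q∣≡∣p∣+∣q∣ p q)
∣p++q∣≡∣p∣+∣q∣ (false ∷ p) q = ∣p++q∣≡∣p∣+∣q∣ p q

∣p∪q∣≤∣p∣+∣q∣ : (p q : Subset n) → ∣ p ∪ q ∣ ≤ ∣ p ∣ + ∣ q ∣
∣p∪q∣≤∣p∣+∣q∣ []          []          = z≤n
∣p∪q∣≤∣p∣+∣q∣ (true  ∷ p) (y     ∷ q) =
  s≤s (≤-trans (∣p∪q∣≤∣p∣+∣q∣ p q) (+-monoʳ-≤ ∣ p ∣ (∣p∣≤∣x∷p∣ y q)))
∣p∪q∣≤∣p∣+∣q∣ (false ∷ p) (true  ∷ q) =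
  ≤-trans (s≤s (∣p∪q∣≤∣p∣+∣q∣ p q)) (≤-reflexive (sym (+-suc ∣ p ∣ ∣ q ∣)))
∣p∪q∣≤∣p∣+∣q∣ (false ∷ p) (false ∷ q) = ∣p∪q∣≤∣p∣+∣q∣ p q

∣p∩q∣+∣p∩∁q∣≡∣p∣ : (p q : Subset n) → ∣ p ∩ q ∣ + ∣ p ∩ ∁ q ∣ ≡ ∣ p ∣
∣p∩q∣+∣p∩∁q∣≡∣p∣ []          []          = refl
∣p∩q∣+∣p∩∁q∣≡∣p∣ (true  ∷ p) (true  ∷ q) = cong ℕ.suc (∣p∩q∣+∣p∩∁q∣≡∣p∣ p q)
∣p∩q∣+∣p∩∁q∣≡∣p∣ (true  ∷ p) (false ∷ q) = trans (+-suc _ _) (cong ℕ.suc (∣p∩q∣+∣p∩∁q∣≡∣p∣ p q))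
∣p∩q∣+∣p∩∁q∣≡∣p∣ (false ∷ p) (_     ∷ q) = ∣p∩q∣+∣p∩∁q∣≡∣p∣ p q

∣∁p∣+∣p∣≡n : (p : Subset n) → ∣ ∁ p ∣ + ∣ p ∣ ≡ n
∣∁p∣+∣p∣≡n p = trans (cong (_+ ∣ p ∣) (∣∁p∣≡n∸∣p∣ p)) (m∸n+n≡m (∣p∣≤n p))

⌊⌋-⇔ : ∀ {a b} {A : Set a} {B : Set b} → A ⇔ B → (a? : Dec A) (b? : Dec B) → ⌊ a? ⌋ ≡ ⌊ b? ⌋
⌊⌋-⇔ A⇔B a? b? = trans (isYes≗does a?) (trans (does-⇔ A⇔B a? b?) (sym (isYes≗does b?)))

⁅i⁆≡tabulate : (i : Fin n) → ⁅ i ⁆ ≡ tabulate (λ j → ⌊ toℕ i ≟ toℕ j ⌋)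
⁅i⁆≡tabulate zero    = cong (true ∷_) (sym (trans (tabulate-allFin _) (map-const _ false)))
⁅i⁆≡tabulate (suc i) = cong (false ∷_) (trans (⁅i⁆≡tabulate i)
  (tabulate-cong λ j → ⌊⌋-⇔ (mk⇔ (cong ℕ.suc) suc-injective) _ _))

∁⁅i⁆≡tabulate : (i : Fin n) → ∁ ⁅ i ⁆ ≡ tabulate (λ j → not ⌊ toℕ i ≟ toℕ j ⌋)
∁⁅i⁆≡tabulate i = trans (cong ∁ (⁅i⁆≡tabulate i)) (sym (tabulate-∘ not _))

tabulate-++ : ∀ {a} {A : Set a} m (f : Fin (m + n) → A) →
              tabulate f ≡ tabulate (f ∘ (_↑ˡ n)) ++ tabulate (f ∘ (m ↑ʳ_))
tabulate-++ ℕ.zero    f = refl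
tabulate-++ (ℕ.suc m) f = cong (f zero ∷_) (tabulate-++ m (f ∘ suc))

minFin-const : ∀ {k c} (f : Fin (ℕ.suc k) → ℕ) → (∀ i → f i ≡ c) → minFin f ≡ c
minFin-const {ℕ.zero}      f f≡c = f≡c zero
minFin-const {ℕ.suc k} {c} f f≡c = begin
  f zero ⊓ minFin (f ∘ suc) ≡⟨ cong₂ _⊓_ (f≡c zero) (minFin-const (f ∘ suc) (f≡c ∘ suc)) ⟩
  c ⊓ c                     ≡⟨ ⊓-idem c ⟩
  c                         ∎
  where open ≡-Reasoning

Closed : Graph n → ℕ → Subset n → Set
Closed G r Y = ∀ {v} → v ∉ Y → ∣ N G v ∩ Y ∣ < r

module _ {n} (G : Graph n) {r : ℕ} where

  ∣N∩∣-mono : ∀ v {X Y : Subset n} → X ⊆ Y → ∣ N G v ∩ X ∣ ≤ ∣ N G v ∩ Y ∣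
  ∣N∩∣-mono v {X} {Y} X⊆Y = p⊆q⇒∣p∣≤∣q∣ {p = N G v ∩ X} {q = N G v ∩ Y} λ w∈ →
    let w∈N , w∈X = x∈p∩q⁻ _ _ w∈ in x∈p∩q⁺ (w∈N , X⊆Y w∈X)

  step-⊆ : ∀ {X Y} → Closed G r Y → X ⊆ Y → step G r X ⊆ Y
  step-⊆ {X} {Y} closed X⊆Y {v} v∈step with x∈p∪q⁻ X _ v∈step
  ... | inj₁ v∈X = X⊆Y v∈X
  ... | inj₂ v∈new with v ∈? Y
  ...   | yes v∈Y = v∈Y
  ...   | no  v∉Y = ⊥-elim (<⇒≱ (closed v∉Y) (≤-trans r≤∣N∩X∣ (∣N∩∣-mono v X⊆Y)))
    where
    r≤∣N∩X∣ : r ≤ ∣ N G v ∩ X ∣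
    r≤∣N∩X∣ = ≤ᵇ⇒≤ r _ (Equivalence.from T-≡ (trans (sym (lookup∘tabulate _ v)) ([]=⇒lookup v∈new)))

  bootstrap-⊆ : ∀ {X Y} → Closed G r Y → X ⊆ Y → ∀ t → bootstrap G r X t ⊆ Y
  bootstrap-⊆ closed X⊆Y ℕ.zero    = X⊆Y
  bootstrap-⊆ closed X⊆Y (ℕ.suc t) = step-⊆ closed (bootstrap-⊆ closed X⊆Y t)

  percolates⇒closed-superset-full : ∀ {X Y} → Percolates G r X → Closed G r Y → X ⊆ Y → ∀ v → v ∈ Y
  percolates⇒closed-superset-full perc closed X⊆Y v =
    let t , v∈ = perc v in bootstrap-⊆ closed X⊆Y t v∈

  closed-∪∁ : ∀ {X S k} → (∀ {v} → v ∈ S → ∣ N G v ∩ ∁ S ∣ ≤ k) → k + ∣ X ∩ S ∣ < r →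
              Closed G r (X ∪ ∁ S)
  closed-∪∁ {X} {S} {k} fewOutside small {v} v∉ = begin-strict
    ∣ N G v ∩ (X ∪ ∁ S) ∣          ≤⟨ p⊆q⇒∣p∣≤∣q∣ split ⟩
    ∣ (N G v ∩ ∁ S) ∪ (X ∩ S) ∣    ≤⟨ ∣p∪q∣≤∣p∣+∣q∣ (N G v ∩ ∁ S) (X ∩ S) ⟩
    ∣ N G v ∩ ∁ S ∣ + ∣ X ∩ S ∣    ≤⟨ +-monoˡ-≤ ∣ X ∩ S ∣ (fewOutside v∈S) ⟩
    k + ∣ X ∩ S ∣                  <⟨ small ⟩
    r                              ∎
    where
    open ≤-Reasoning
    v∈S : v ∈ S
    v∈S = x∉∁p⇒x∈p (λ v∈∁S → v∉ (x∈p∪q⁺ (inj₂ v∈∁S)))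
    split : N G v ∩ (X ∪ ∁ S) ⊆ (N G v ∩ ∁ S) ∪ (X ∩ S)
    split {w} w∈ with x∈p∩q⁻ (N G v) _ w∈
    ... | w∈N , w∈X∪∁S with x∈p∪q⁻ X (∁ S) w∈X∪∁S | w ∈? ∁ S
    ...   | _        | yes w∈∁S = x∈p∪q⁺ (inj₁ (x∈p∩q⁺ (w∈N , w∈∁S)))
    ...   | inj₁ w∈X | no  w∉∁S = x∈p∪q⁺ (inj₂ (x∈p∩q⁺ (w∈X , x∉∁p⇒x∈p w∉∁S)))
    ...   | inj₂ w∈∁S | no w∉∁S = ⊥-elim (w∉∁S w∈∁S)

  percolates⇒meets : ∀ {X S k} → Percolates G r X → (∀ {v} → v ∈ S → ∣ N G v ∩ ∁ S ∣ ≤ k) →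
                     r ≤ k + ∣ S ∣ → r ≤ k + ∣ X ∩ S ∣
  percolates⇒meets {X} {S} {k} perc fewOutside r≤k+∣S∣ with r ≤? k + ∣ X ∩ S ∣
  ... | yes r≤ = r≤
  ... | no  r≰ = ≤-trans r≤k+∣S∣ (+-monoʳ-≤ k (p⊆q⇒∣p∣≤∣q∣ S⊆X∩S))
    where
    S⊆X∩S : S ⊆ X ∩ S
    S⊆X∩S {v} v∈S with x∈p∪q⁻ X (∁ S) (percolates⇒closed-superset-full perc
                                         (closed-∪∁ fewOutside (≰⇒> r≰)) (p⊆p∪q (∁ S)) v)
    ... | inj₁ v∈X  = x∈p∩q⁺ (v∈X , v∈S)
    ... | inj₂ v∈∁S = ⊥-elim (x∈p⇒x∉∁p v∈S v∈∁S)

⌊⌋-false : ∀ {a} {A : Set a} (a? : Dec A) → ¬ A → ⌊ a? ⌋ ≡ false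
⌊⌋-false a? ¬a = trans (isYes≗does a?) (dec-false a? ¬a)

<ᵇ-true : ∀ {a h} → a < h → (a <ᵇ h) ≡ true
<ᵇ-true {a} {h} = dec-true (a <? h)

<ᵇ-false : ∀ {a h} → h ≤ a → (a <ᵇ h) ≡ false
<ᵇ-false {a} {h} h≤a = dec-false (a <? h) (≤⇒≯ h≤a)

module _ (h : ℕ) where

  twoCliquesAdjℕ-<-< : ∀ {a b} → a < h → b < h → twoCliquesAdjℕ h a b ≡ not ⌊ a ≟ b ⌋
  twoCliquesAdjℕ-<-< a<h b<h rewrite <ᵇ-true a<h | <ᵇ-true b<h = ∧-identityʳ _

  twoCliquesAdjℕ-<-+ : ∀ {a} b → a < h → twoCliquesAdjℕ h a (h + b) ≡ ⌊ a ≟ b ⌋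
  twoCliquesAdjℕ-<-+ {a} b a<h
    rewrite <ᵇ-true a<h | <ᵇ-false (m≤m+n h b)
          | ⌊⌋-false (a ≟ h + b) (λ a≡h+b → <⇒≱ a<h (subst (h ≤_) (sym a≡h+b) (m≤m+n h b)))
          | ⌊⌋-false (h + b + h ≟ a) (λ h+b+h≡a → <⇒≱ a<h (subst (h ≤_) h+b+h≡a (m≤n+m h (h + b))))
    = trans (∨-identityʳ _) (⌊⌋-⇔ (mk⇔ to from) _ _)
    where
    to : a + h ≡ h + b → a ≡ b
    to a+h≡h+b = +-cancelʳ-≡ h a b (trans a+h≡h+b (+-comm h b))
    from : a ≡ b → a + h ≡ h + b
    from refl = +-comm a h

  twoCliquesAdjℕ-+-+ : ∀ a b → twoCliquesAdjℕ h (h + a) (h + b) ≡ not ⌊ a ≟ b ⌋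
  twoCliquesAdjℕ-+-+ a b rewrite <ᵇ-false (m≤m+n h a) | <ᵇ-false (m≤m+n h b)
    = trans (∧-identityʳ _) (cong not (⌊⌋-⇔ (mk⇔ (+-cancelˡ-≡ h a b) (cong (h +_))) _ _))

data SplitView (m : ℕ) {n : ℕ} : Fin (m + n) → Set where
  left  : (i : Fin m) → SplitView m (i ↑ˡ n)
  right : (j : Fin n) → SplitView m (m ↑ʳ j)

splitView : ∀ m {n} (k : Fin (m + n)) → SplitView m k
splitView ℕ.zero    k       = right k
splitView (ℕ.suc m) zero    = left zero
splitView (ℕ.suc m) (suc k) with splitView m k
... | left  i = left (suc i)
... | right j = right j

↑ˡ∉⊥++⊤ : (i : Fin m) → i ↑ˡ n ∉ ⊥ {m} ++ ⊤ {n}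
↑ˡ∉⊥++⊤ zero    ()
↑ˡ∉⊥++⊤ (suc i) (there i∈) = ↑ˡ∉⊥++⊤ i i∈

↑ʳ∉⊤++⊥ : ∀ m (j : Fin n) → m ↑ʳ j ∉ ⊤ {m} ++ ⊥ {n}
↑ʳ∉⊤++⊥ ℕ.zero    j = ∉⊥
↑ʳ∉⊤++⊥ (ℕ.suc m) j (there j∈) = ↑ʳ∉⊤++⊥ m j j∈

∣[p++q]∩[⊤++⊥]∣≡∣p∣ : ∀ {m n} (p : Subset m) (q : Subset n) →
                      ∣ (p ++ q) ∩ (⊤ {m} ++ ⊥ {n}) ∣ ≡ ∣ p ∣
∣[p++q]∩[⊤++⊥]∣≡∣p∣ {m} {n} p q = begin
  ∣ (p ++ q) ∩ (⊤ {m} ++ ⊥ {n}) ∣  ≡⟨ cong ∣_∣ (zipWith-++ _∧_ p q (⊤ {m}) (⊥ {n})) ⟩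
  ∣ (p ∩ ⊤) ++ (q ∩ ⊥) ∣   ≡⟨ ∣p++q∣≡∣p∣+∣q∣ (p ∩ ⊤) (q ∩ ⊥) ⟩
  ∣ p ∩ ⊤ ∣ + ∣ q ∩ ⊥ ∣    ≡⟨ cong₂ _+_ (cong ∣_∣ (∩-identityʳ p)) (cong ∣_∣ (∩-zeroʳ q)) ⟩
  ∣ p ∣ + ∣ ⊥ {n} ∣        ≡⟨ cong (∣ p ∣ +_) (∣⊥∣≡0 n) ⟩
  ∣ p ∣ + 0                ≡⟨ +-identityʳ ∣ p ∣ ⟩
  ∣ p ∣                    ∎
  where open ≡-Reasoning

∣[p++q]∩[⊥++⊤]∣≡∣q∣ : ∀ {m n} (p : Subset m) (q : Subset n) →
                      ∣ (p ++ q) ∩ (⊥ {m} ++ ⊤ {n}) ∣ ≡ ∣ q ∣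
∣[p++q]∩[⊥++⊤]∣≡∣q∣ {m} {n} p q = begin
  ∣ (p ++ q) ∩ (⊥ {m} ++ ⊤ {n}) ∣  ≡⟨ cong ∣_∣ (zipWith-++ _∧_ p q (⊥ {m}) (⊤ {n})) ⟩
  ∣ (p ∩ ⊥) ++ (q ∩ ⊤) ∣   ≡⟨ ∣p++q∣≡∣p∣+∣q∣ (p ∩ ⊥) (q ∩ ⊤) ⟩
  ∣ p ∩ ⊥ ∣ + ∣ q ∩ ⊤ ∣    ≡⟨ cong₂ _+_ (cong ∣_∣ (∩-zeroʳ p)) (cong ∣_∣ (∩-identityʳ q)) ⟩
  ∣ ⊥ {m} ∣ + ∣ q ∣        ≡⟨ cong (_+ ∣ q ∣) (∣⊥∣≡0 m) ⟩
  ∣ q ∣                    ∎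
  where open ≡-Reasoning

m+m≡m*2 : ∀ m → m + m ≡ m * 2
m+m≡m*2 m = trans (cong (m +_) (sym (+-identityʳ m))) (*-comm 2 m)

[m+m]/2≡m : ∀ m → (m + m) / 2 ≡ m
[m+m]/2≡m m = trans (cong (_/ 2) (m+m≡m*2 m)) (m*n/n≡m m 2)

module TwoCliquesMatching (h : ℕ) where

  G : Graph (h + h)
  G = twoCliquesMatching (h + h)

  A B : Subset (h + h)
  A = ⊤ {h} ++ ⊥ {h}
  B = ⊥ {h} ++ ⊤ {h}

  adj≡twoCliquesAdjℕ : ∀ {u v a b} → toℕ u ≡ a → toℕ v ≡ b → adj G u v ≡ twoCliquesAdjℕ h a b
  adj≡twoCliquesAdjℕ {u} {v} refl refl = cong (λ k → twoCliquesAdjℕ k (toℕ u) (toℕ v)) ([m+m]/2≡m h)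

  adj-↑ˡ-↑ˡ : (i j : Fin h) → adj G (i ↑ˡ h) (j ↑ˡ h) ≡ not ⌊ toℕ i ≟ toℕ j ⌋
  adj-↑ˡ-↑ˡ i j = trans (adj≡twoCliquesAdjℕ (toℕ-↑ˡ i h) (toℕ-↑ˡ j h))
                        (twoCliquesAdjℕ-<-< h (toℕ<n i) (toℕ<n j))

  adj-↑ˡ-↑ʳ : (i j : Fin h) → adj G (i ↑ˡ h) (h ↑ʳ j) ≡ ⌊ toℕ i ≟ toℕ j ⌋
  adj-↑ˡ-↑ʳ i j = trans (adj≡twoCliquesAdjℕ (toℕ-↑ˡ i h) (toℕ-↑ʳ h j))
                        (twoCliquesAdjℕ-<-+ h (toℕ j) (toℕ<n i))

  adj-↑ʳ-↑ˡ : (j i : Fin h) → adj G (h ↑ʳ j) (i ↑ˡ h) ≡ ⌊ toℕ j ≟ toℕ i ⌋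
  adj-↑ʳ-↑ˡ j i = trans (symm G _ _) (trans (adj-↑ˡ-↑ʳ i j) (⌊⌋-⇔ (mk⇔ sym sym) _ _))

  adj-↑ʳ-↑ʳ : (i j : Fin h) → adj G (h ↑ʳ i) (h ↑ʳ j) ≡ not ⌊ toℕ i ≟ toℕ j ⌋
  adj-↑ʳ-↑ʳ i j = trans (adj≡twoCliquesAdjℕ (toℕ-↑ʳ h i) (toℕ-↑ʳ h j))
                        (twoCliquesAdjℕ-+-+ h (toℕ i) (toℕ j))

  N-↑ˡ : (i : Fin h) → N G (i ↑ˡ h) ≡ ∁ ⁅ i ⁆ ++ ⁅ i ⁆
  N-↑ˡ i = trans (tabulate-++ h _) (cong₂ _++_
    (trans (tabulate-cong (adj-↑ˡ-↑ˡ i)) (sym (∁⁅i⁆≡tabulate i)))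
    (trans (tabulate-cong (adj-↑ˡ-↑ʳ i)) (sym (⁅i⁆≡tabulate i))))

  N-↑ʳ : (j : Fin h) → N G (h ↑ʳ j) ≡ ⁅ j ⁆ ++ ∁ ⁅ j ⁆
  N-↑ʳ j = trans (tabulate-++ h _) (cong₂ _++_
    (trans (tabulate-cong (adj-↑ʳ-↑ˡ j)) (sym (⁅i⁆≡tabulate j)))
    (trans (tabulate-cong (adj-↑ʳ-↑ʳ j)) (sym (∁⁅i⁆≡tabulate j))))

  degree≡h : ∀ v → degree G v ≡ h
  degree≡h v with splitView h v
  ... | left i  = begin
    ∣ N G (i ↑ˡ h) ∣           ≡⟨ cong ∣_∣ (N-↑ˡ i) ⟩
    ∣ ∁ ⁅ i ⁆ ++ ⁅ i ⁆ ∣       ≡⟨ ∣p++q∣≡∣p∣+∣q∣ (∁ ⁅ i ⁆) ⁅ i ⁆ ⟩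
    ∣ ∁ ⁅ i ⁆ ∣ + ∣ ⁅ i ⁆ ∣    ≡⟨ ∣∁p∣+∣p∣≡n ⁅ i ⁆ ⟩
    h                          ∎
    where open ≡-Reasoning
  ... | right j = begin
    ∣ N G (h ↑ʳ j) ∣           ≡⟨ cong ∣_∣ (N-↑ʳ j) ⟩
    ∣ ⁅ j ⁆ ++ ∁ ⁅ j ⁆ ∣       ≡⟨ ∣p++q∣≡∣p∣+∣q∣ ⁅ j ⁆ (∁ ⁅ j ⁆) ⟩
    ∣ ⁅ j ⁆ ∣ + ∣ ∁ ⁅ j ⁆ ∣    ≡⟨ +-comm ∣ ⁅ j ⁆ ∣ _ ⟩
    ∣ ∁ ⁅ j ⁆ ∣ + ∣ ⁅ j ⁆ ∣    ≡⟨ ∣∁p∣+∣p∣≡n ⁅ j ⁆ ⟩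
    h                          ∎
    where open ≡-Reasoning

  ∁A≡B : ∁ A ≡ B
  ∁A≡B = trans (map-++ not (⊤ {h}) (⊥ {h}))
               (cong₂ _++_ (map-replicate not true h) (map-replicate not false h))

  ∁B≡A : ∁ B ≡ A
  ∁B≡A = trans (map-++ not (⊥ {h}) (⊤ {h}))
               (cong₂ _++_ (map-replicate not false h) (map-replicate not true h))

  ∣A∣≡h : ∣ A ∣ ≡ h
  ∣A∣≡h = trans (∣p++q∣≡∣p∣+∣q∣ (⊤ {h}) (⊥ {h}))
                (trans (cong₂ _+_ (∣⊤∣≡n h) (∣⊥∣≡0 h)) (+-identityʳ h))

  ∣B∣≡h : ∣ B ∣ ≡ h
  ∣B∣≡h = trans (∣p++q∣≡∣p∣+∣q∣ (⊥ {h}) (⊤ {h})) (cong₂ _+_ (∣⊥∣≡0 h) (∣⊤∣≡n h))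

  ∣N∩∁A∣≤1 : ∀ {v} → v ∈ A → ∣ N G v ∩ ∁ A ∣ ≤ 1
  ∣N∩∁A∣≤1 {v} v∈A with splitView h v
  ... | left  i = ≤-reflexive (begin
    ∣ N G (i ↑ˡ h) ∩ ∁ A ∣       ≡⟨ cong₂ (λ p q → ∣ p ∩ q ∣) (N-↑ˡ i) ∁A≡B ⟩
    ∣ (∁ ⁅ i ⁆ ++ ⁅ i ⁆) ∩ B ∣   ≡⟨ ∣[p++q]∩[⊥++⊤]∣≡∣q∣ (∁ ⁅ i ⁆) ⁅ i ⁆ ⟩
    ∣ ⁅ i ⁆ ∣                    ≡⟨ ∣⁅x⁆∣≡1 i ⟩
    1                            ∎)
    where open ≡-Reasoning
  ... | right j = ⊥-elim (↑ʳ∉⊤++⊥ h j v∈A)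

  ∣N∩∁B∣≤1 : ∀ {v} → v ∈ B → ∣ N G v ∩ ∁ B ∣ ≤ 1
  ∣N∩∁B∣≤1 {v} v∈B with splitView h v
  ... | left  i = ⊥-elim (↑ˡ∉⊥++⊤ i v∈B)
  ... | right j = ≤-reflexive (begin
    ∣ N G (h ↑ʳ j) ∩ ∁ B ∣       ≡⟨ cong₂ (λ p q → ∣ p ∩ q ∣) (N-↑ʳ j) ∁B≡A ⟩
    ∣ (⁅ j ⁆ ++ ∁ ⁅ j ⁆) ∩ A ∣   ≡⟨ ∣[p++q]∩[⊤++⊥]∣≡∣p∣ ⁅ j ⁆ (∁ ⁅ j ⁆) ⟩
    ∣ ⁅ j ⁆ ∣                    ≡⟨ ∣⁅x⁆∣≡1 j ⟩
    1                            ∎)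
    where open ≡-Reasoning

  δ≡[h+h]/2 : 1 ≤ h → δ G ≡ (h + h) / 2
  δ≡[h+h]/2 (s≤s _) = trans (minFin-const (degree G) degree≡h) (sym ([m+m]/2≡m h))

  m[G,3]>3 : 2 ≤ h → MGreater G 3 3
  m[G,3]>3 2≤h X perc = begin-strict
    3                        <⟨ ≤-refl ⟩
    2 + 2                    ≤⟨ +-mono-≤ (meets ∣N∩∁A∣≤1 ∣A∣≡h) (meets ∣N∩∁B∣≤1 ∣B∣≡h) ⟩
    ∣ X ∩ A ∣ + ∣ X ∩ B ∣    ≡⟨ cong (λ S → ∣ X ∩ A ∣ + ∣ X ∩ S ∣) (sym ∁A≡B) ⟩
    ∣ X ∩ A ∣ + ∣ X ∩ ∁ A ∣  ≡⟨ ∣p∩q∣+∣p∩∁q∣≡∣p∣ X A ⟩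
    ∣ X ∣                    ∎
    where
    open ≤-Reasoning
    meets : ∀ {S} → (∀ {v} → v ∈ S → ∣ N G v ∩ ∁ S ∣ ≤ 1) → ∣ S ∣ ≡ h → 2 ≤ ∣ X ∩ S ∣
    meets fewOutside ∣S∣≡h =
      s≤s⁻¹ (percolates⇒meets G perc fewOutside (s≤s (subst (2 ≤_) (sym ∣S∣≡h) 2≤h)))

theorem2p3 : (n : ℕ) → 4 ≤ n → n % 2 ≡ 0 →
    (δ (twoCliquesMatching n) ≡ n / 2) × MGreater (twoCliquesMatching n) 3 3
theorem2p3 n 4≤n n%2≡0 = subst P (sym n≡h+h) (δ≡[h+h]/2 (≤-trans (s≤s z≤n) 2≤h) , m[G,3]>3 2≤h)
  where
  h : ℕ
  h = n / 2
  open TwoCliquesMatching h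
  P : ℕ → Set
  P k = (δ (twoCliquesMatching k) ≡ k / 2) × MGreater (twoCliquesMatching k) 3 3
  n≡h*2 : n ≡ h * 2
  n≡h*2 = trans (m≡m%n+[m/n]*n n 2) (cong (_+ h * 2) n%2≡0)
  n≡h+h : n ≡ h + h
  n≡h+h = trans n≡h*2 (sym (m+m≡m*2 h))
  2≤h : 2 ≤ h
  2≤h = *-cancelʳ-≤ 2 h 2 (subst (4 ≤_) n≡h*2 4≤n)
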